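{- Let $m$ be an odd positive integer and $r$ a positive integer with $m\geqslant 2r-1$, and let $$O_{m,r}=\mathtt1^{m}\mathtt0^{m-2}\mathtt1^{m-4}\mathtt0^{m-6}\cdots$$ be the binary word consisting of $r$ runs, alternating between $\mathtt1$-runs and $\mathtt0$-runs starting with a $\mathtt1$-run, whose lengths are $m,m-2,m-4,\dots,m-2r+2$. Then $O_{m,r}$ contains twins of total (double) length at least $|O_{m,r}|-23$.
   Context: $w^k$ denotes $k$ consecutive copies of letter $w$; $|W|$ is the length of $W$. Twins in a word $W$ are two subsequences $X,Y$ of $W$ with disjoint sets of positions such that $X=Y$ as words; their total (double) length is $2|X|$. -}

module Defs where

open import Data.Nat using (ℕ; zero; suc; _+_; _*_; _∸_; _<_)
open import Data.Nat.Base using (_%_)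
open import Data.Bool using (Bool; true; false)
open import Data.List using (List; []; _++_; replicate; length; lookup)
open import Data.Fin using (Fin) renaming (_<_ to _<ᶠ_)
open import Data.Product using (Σ; _×_)
open import Relation.Binary.PropositionalEquality using (_≡_; _≢_)

-- Binary words: List Bool, with true = letter 1 and false = letter 0.
Word : Set
Word = List Bool

runLetter : ℕ → Bool
runLetter zero = true
runLetter (suc zero) = false
runLetter (suc (suc i)) = runLetter i

runsFrom : ℕ → ℕ → ℕ → Word
runsFrom m i zero = []
runsFrom m i (suc k) = replicate (m ∸ 2 * i) (runLetter i) ++ runsFrom m (suc i) k

O : ℕ → ℕ → Word
O m r = runsFrom m 0 r

record Twins (W : Word) (k : ℕ) : Set where
  field
    f g     : Fin k → Fin (length W)
    f-incr  : ∀ {i j} → i <ᶠ j → f i <ᶠ f j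
    g-incr  : ∀ {i j} → i <ᶠ j → g i <ᶠ g j
    disjoint : ∀ i j → f i ≢ g j
    equal   : ∀ i → lookup W (f i) ≡ lookup W (g i)

Odd : ℕ → Set
Odd m = m % 2 ≡ 1

{-# OPTIONS --safe #-}
-- Each run of O m r gives some of its letters to the first twin, some to the second and wastes
-- the rest.  Halving every run wastes one letter per run, which settles r ≤ 8.  Otherwise the
-- runs after the first fall into blocks of eight runs 0^(e+14) 1^(e+12) … 1^e, followed by
-- fewer than eight more runs.  A block splits without waste so that a second twin lagging 1^9
-- behind the first on entering the block lags 1^9 behind on leaving it.  The first run, of odd
-- length 2a + 9, creates the lag, the last block removes it by wasting 9 letters and the
-- remaining runs are halved, so at most 9 + 7 letters are wasted.
module Submission where

open import Defs
open import Data.Bool using (Bool; true)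
open import Data.Fin using (Fin; zero; suc) renaming (_<_ to _<ᶠ_)
open import Data.Fin.Properties using (suc-injective)
open import Data.List using (List; []; _∷_; _++_; length; replicate; lookup)
open import Data.List.Properties using (length-++; length-replicate)
open import Data.Nat using (ℕ; zero; suc; _+_; _*_; _∸_; _≤_; _≥_; _<_; z≤n; s≤s; _/_; _%_)
open import Data.Nat.DivMod using (m≡m%n+[m/n]*n; m%n<n)
open import Data.Nat.Properties
  using ( +-assoc; +-comm; +-identityʳ; +-suc; *-comm; *-suc; *-distribˡ-+; *-cancelˡ-≤
        ; ≤-trans; ≤-pred; +-mono-≤; +-monoˡ-≤; +-monoʳ-≤; ∸-monoˡ-≤; m≤m+n
        ; m+n∸n≡m; m+n∸m≡n; m+[n∸m]≡n; module ≤-Reasoning )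
open import Data.Nat.Tactic.RingSolver using (solve-∀)
open import Data.Product using (Σ; _×_; _,_)
open import Relation.Binary.PropositionalEquality
  using (_≡_; _≢_; refl; sym; trans; cong; cong₂; subst; module ≡-Reasoning)

variable
  A : Set
  w x y z d : Word
  b : Bool
  n : ℕ

replicate-+-++ : ∀ k l (a : A) xs → replicate (k + l) a ++ xs ≡ replicate k a ++ (replicate l a ++ xs)
replicate-+-++ zero    l a xs = refl
replicate-+-++ (suc k) l a xs = cong (a ∷_) (replicate-+-++ k l a xs)

replicate-++-comm : ∀ k l (a : A) xs →
                    replicate k a ++ (replicate l a ++ xs) ≡ replicate l a ++ (replicate k a ++ xs)
replicate-++-comm k l a xs = begin
  replicate k a ++ (replicate l a ++ xs) ≡⟨ replicate-+-++ k l a xs ⟨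
  replicate (k + l) a ++ xs              ≡⟨ cong (λ j → replicate j a ++ xs) (+-comm k l) ⟩
  replicate (l + k) a ++ xs              ≡⟨ replicate-+-++ l k a xs ⟩
  replicate l a ++ (replicate k a ++ xs) ∎
  where open ≡-Reasoning

data Shuffle : Word → Word → Word → Word → Set where
  []    : Shuffle [] [] [] []
  left  : Shuffle w x y z → Shuffle (b ∷ w) (b ∷ x) y z
  right : Shuffle w x y z → Shuffle (b ∷ w) x (b ∷ y) z
  skip  : Shuffle w x y z → Shuffle (b ∷ w) x y (b ∷ z)

swap : Shuffle w x y z → Shuffle w y x z
swap []        = []
swap (left s)  = right (swap s)
swap (right s) = left (swap s)
swap (skip s)  = skip (swap s)

length-shuffle : Shuffle w x y z → length w ≡ length x + length y + length z
length-shuffle [] = refl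
length-shuffle (left s) = cong suc (length-shuffle s)
length-shuffle {x = x} {b ∷ y} {z} (right s) =
  trans (cong suc (length-shuffle s)) (cong (_+ length z) (sym (+-suc (length x) (length y))))
length-shuffle {x = x} {y} {b ∷ z} (skip s) =
  trans (cong suc (length-shuffle s)) (sym (+-suc (length x + length y) (length z)))

leftIndex : Shuffle w x y z → Fin (length x) → Fin (length w)
leftIndex (left s) zero    = zero
leftIndex (left s) (suc i) = suc (leftIndex s i)
leftIndex (right s) i      = suc (leftIndex s i)
leftIndex (skip s) i       = suc (leftIndex s i)

leftIndex-mono-< : (s : Shuffle w x y z) {i j : Fin (length x)} →
                   i <ᶠ j → leftIndex s i <ᶠ leftIndex s j
leftIndex-mono-< (left s) {zero} {suc j} i<j        = s≤s z≤n
leftIndex-mono-< (left s) {suc i} {suc j} (s≤s i<j) = s≤s (leftIndex-mono-< s i<j)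
leftIndex-mono-< (right s) i<j                      = s≤s (leftIndex-mono-< s i<j)
leftIndex-mono-< (skip s) i<j                       = s≤s (leftIndex-mono-< s i<j)

lookup-leftIndex : (s : Shuffle w x y z) (i : Fin (length x)) → lookup w (leftIndex s i) ≡ lookup x i
lookup-leftIndex (left s) zero    = refl
lookup-leftIndex (left s) (suc i) = lookup-leftIndex s i
lookup-leftIndex (right s) i      = lookup-leftIndex s i
lookup-leftIndex (skip s) i       = lookup-leftIndex s i

leftIndex≢rightIndex : (s : Shuffle w x y z) (i : Fin (length x)) (j : Fin (length y)) →
                       leftIndex s i ≢ leftIndex (swap s) j
leftIndex≢rightIndex (left s) zero j ()
leftIndex≢rightIndex (left s) (suc i) j eq = leftIndex≢rightIndex s i j (suc-injective eq)
leftIndex≢rightIndex (right s) i zero ()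
leftIndex≢rightIndex (right s) i (suc j) eq = leftIndex≢rightIndex s i j (suc-injective eq)
leftIndex≢rightIndex (skip s) i j eq = leftIndex≢rightIndex s i j (suc-injective eq)

shuffle⇒twins : Shuffle w x x z → Twins w (length x)
shuffle⇒twins s = record
  { f        = leftIndex s
  ; g        = leftIndex (swap s)
  ; f-incr   = leftIndex-mono-< s
  ; g-incr   = leftIndex-mono-< (swap s)
  ; disjoint = leftIndex≢rightIndex s
  ; equal    = λ i → trans (lookup-leftIndex s i) (sym (lookup-leftIndex (swap s) i))
  }

lefts : ∀ k b → Shuffle w x y z → Shuffle (replicate k b ++ w) (replicate k b ++ x) y z
lefts zero    b s = s
lefts (suc k) b s = left (lefts k b s)

rights : ∀ k b → Shuffle w x y z → Shuffle (replicate k b ++ w) x (replicate k b ++ y) z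
rights zero    b s = s
rights (suc k) b s = right (rights k b s)

skips : ∀ k b → Shuffle w x y z → Shuffle (replicate k b ++ w) x y (replicate k b ++ z)
skips zero    b s = s
skips (suc k) b s = skip (skips k b s)

shuffle-replicate : ∀ p q r b → p + q + r ≡ n → Shuffle w x y z →
  Shuffle (replicate n b ++ w) (replicate p b ++ x) (replicate q b ++ y) (replicate r b ++ z)
shuffle-replicate {w = w} p q r b refl s =
  subst (λ v → Shuffle v _ _ _) (sym split) (lefts p b (rights q b (skips r b s)))
  where
    split : replicate (p + q + r) b ++ w ≡ replicate p b ++ (replicate q b ++ (replicate r b ++ w))
    split = trans (replicate-+-++ (p + q) r b w) (replicate-+-++ p q b (replicate r b ++ w))

record OffsetTwins (d : Word) (n : ℕ) (w : Word) : Set where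
  constructor offsetTwins
  field
    {twin waste} : Word
    shuffle      : Shuffle w twin (d ++ twin) waste
    waste-≤      : length waste ≤ n

offsetTwins-[] : OffsetTwins [] 0 []
offsetTwins-[] = offsetTwins [] z≤n

offsetTwins-weaken : ∀ {n n′} → n ≤ n′ → OffsetTwins d n w → OffsetTwins d n′ w
offsetTwins-weaken n≤n′ (offsetTwins s waste≤n) = offsetTwins s (≤-trans waste≤n n≤n′)

offsetTwins⇒twins : OffsetTwins [] n w → Σ ℕ (λ k → Twins w k × length w ∸ n ≤ 2 * k)
offsetTwins⇒twins {n} {w} (offsetTwins {x} {z} s waste≤n) = length x , shuffle⇒twins s , bound
  where
    k = length x
    bound : length w ∸ n ≤ 2 * k
    bound = begin
      length w ∸ n         ≡⟨ cong (_∸ n) (length-shuffle s) ⟩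
      k + k + length z ∸ n ≤⟨ ∸-monoˡ-≤ n (+-monoʳ-≤ (k + k) waste≤n) ⟩
      k + k + n ∸ n        ≡⟨ m+n∸n≡m (k + k) n ⟩
      k + k                ≡⟨ cong (k +_) (+-identityʳ k) ⟨
      2 * k                ∎
      where open ≤-Reasoning

half+half+parity : ∀ L → L / 2 + L / 2 + L % 2 ≡ L
half+half+parity L = trans (h+h+r≡r+h*2 (L / 2) (L % 2)) (sym (m≡m%n+[m/n]*n L 2))
  where
    h+h+r≡r+h*2 : ∀ h r → h + h + r ≡ r + h * 2
    h+h+r≡r+h*2 = solve-∀

offsetTwins-halve : ∀ L b → OffsetTwins [] n w → OffsetTwins [] (suc n) (replicate L b ++ w)
offsetTwins-halve {n} L b (offsetTwins {waste = z} s waste≤n) =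
  offsetTwins (shuffle-replicate (L / 2) (L / 2) (L % 2) b (half+half+parity L) s) bound
  where
    bound : length (replicate (L % 2) b ++ z) ≤ suc n
    bound = begin
      length (replicate (L % 2) b ++ z)         ≡⟨ length-++ (replicate (L % 2) b) ⟩
      length (replicate (L % 2) b) + length z   ≡⟨ cong (_+ length z) (length-replicate (L % 2)) ⟩
      L % 2 + length z                          ≤⟨ +-mono-≤ (≤-pred (m%n<n L 2)) waste≤n ⟩
      suc n                                     ∎
      where open ≤-Reasoning

stairs : ℕ → ℕ → ℕ → Word → Word
stairs i zero    e w = w
stairs i (suc k) e w = replicate (2 * k + e) (runLetter i) ++ stairs (suc i) k e w

2*[k+l]+e≡2*k+[2*l+e] : ∀ k l e → 2 * (k + l) + e ≡ 2 * k + (2 * l + e)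
2*[k+l]+e≡2*k+[2*l+e] k l e = trans (cong (_+ e) (*-distribˡ-+ 2 k l)) (+-assoc (2 * k) (2 * l) e)

stair-length : ∀ i k e → 2 * (i + k) + e ∸ 2 * i ≡ 2 * k + e
stair-length i k e = trans (cong (_∸ 2 * i) (2*[k+l]+e≡2*k+[2*l+e] i k e)) (m+n∸m≡n (2 * i) (2 * k + e))

runsFrom-stairs : ∀ i k e → runsFrom (2 * (i + k) + e) i (suc k) ≡ stairs i (suc k) e []
runsFrom-stairs i zero e =
  cong (λ l → replicate l (runLetter i) ++ []) (stair-length i 0 e)
runsFrom-stairs i (suc k) e =
  cong₂ (λ l v → replicate l (runLetter i) ++ v) (stair-length i (suc k) e)
    (trans (cong (λ j → runsFrom (2 * j + e) (suc i) (suc k)) (+-suc i k))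
           (runsFrom-stairs (suc i) k e))

stairs-+ : ∀ i k l e w → stairs i (k + l) e w ≡ stairs i k (2 * l + e) (stairs (k + i) l e w)
stairs-+ i zero    l e w = refl
stairs-+ i (suc k) l e w =
  cong₂ (λ j v → replicate j (runLetter i) ++ v) (2*[k+l]+e≡2*k+[2*l+e] k l e)
    (trans (stairs-+ (suc i) k l e w)
           (cong (λ j → stairs (suc i) k (2 * l + e) (stairs j l e w)) (+-suc k i)))

offsetTwins-halves : ∀ i k e → OffsetTwins [] n w → OffsetTwins [] (k + n) (stairs i k e w)
offsetTwins-halves i zero    e ot = ot
offsetTwins-halves i (suc k) e ot =
  offsetTwins-halve (2 * k + e) (runLetter i) (offsetTwins-halves (suc i) k e ot)

-- In a block u^(e+14) v^(e+12) u^(e+10) … v^e the first twin reads u^(e+14) v^(e+3) u^(e+2) v^(e+9)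
-- and the second v^9 u^(e+14) v^(e+3) u^(e+2) v^e.
offsetTwins-block : ∀ s e → OffsetTwins (replicate 9 (runLetter (suc s))) n w →
                    OffsetTwins (replicate 9 (runLetter (suc s))) n (stairs s 8 e w)
offsetTwins-block {w = w} s e (offsetTwins {x} {z} sh waste≤n) = offsetTwins
  (subst (λ y → Shuffle (stairs s 8 e w) x′ y z) lag
    (lefts (14 + e) u (rights 9 v (lefts (3 + e) v (rights 8 u (lefts (2 + e) u
    (lefts (8 + e) v (rights (6 + e) u (lefts 1 v (rights (3 + e) v
    (rights (2 + e) u (rights e v sh))))))))))))
  waste≤n
  where
    u v : Bool
    u = runLetter s
    v = runLetter (suc s)
    x′ : Word
    x′ = replicate (14 + e) u ++ (replicate (3 + e) v ++ (replicate (2 + e) u ++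
           (replicate (8 + e) v ++ (replicate 1 v ++ x))))
    v-tail : replicate e v ++ (replicate 9 v ++ x) ≡ replicate (8 + e) v ++ (replicate 1 v ++ x)
    v-tail = trans (replicate-++-comm e 9 v x) (cong (replicate 8 v ++_) (replicate-++-comm 1 e v x))
    lag : replicate 9 v ++ (replicate (14 + e) u ++ (replicate (3 + e) v ++ (replicate (2 + e) u ++
            (replicate e v ++ (replicate 9 v ++ x)))))
        ≡ replicate 9 v ++ x′
    lag = cong (λ t → replicate 9 v ++ (replicate (14 + e) u ++ (replicate (3 + e) v ++
            (replicate (2 + e) u ++ t)))) v-tail

-- The split of offsetTwins-block, with the 9 letters v that carried the lag wasted instead.
offsetTwins-lastBlock : ∀ s e → OffsetTwins [] n w →
                        OffsetTwins (replicate 9 (runLetter (suc s))) (9 + n) (stairs s 8 e w)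
offsetTwins-lastBlock s e (offsetTwins sh waste≤n) = offsetTwins
  (lefts (14 + e) u (rights 9 v (lefts (3 + e) v (rights 8 u (lefts (2 + e) u
    (skips 8 v (lefts e v (rights (6 + e) u (skips 1 v (rights (3 + e) v
    (rights (2 + e) u (rights e v sh))))))))))))
  (+-monoʳ-≤ 9 waste≤n)
  where
    u v : Bool
    u = runLetter s
    v = runLetter (suc s)

offsetTwins-blocks : ∀ K s e → OffsetTwins [] n w →
                     OffsetTwins (replicate 9 (runLetter (suc s))) (9 + n) (stairs s (suc K * 8) e w)
offsetTwins-blocks zero s e ot = offsetTwins-lastBlock s e ot
offsetTwins-blocks {w = w} (suc K) s e ot =
  subst (OffsetTwins _ _) (sym (stairs-+ s 8 (suc K * 8) e w))
    (offsetTwins-block s (2 * (suc K * 8) + e) (offsetTwins-blocks K (8 + s) e ot))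

offsetTwins-absorb : ∀ a L b → a + 9 + a ≡ L → OffsetTwins (replicate 9 b) n w →
                     OffsetTwins [] n (replicate L b ++ w)
offsetTwins-absorb {w = w} a L b refl (offsetTwins sh waste≤n) =
  offsetTwins (subst (λ v → Shuffle v _ _ _) (sym split) (lefts a b (lefts 9 b (rights a b sh))))
              waste≤n
  where
    split : replicate (a + 9 + a) b ++ w ≡ replicate a b ++ (replicate 9 b ++ (replicate a b ++ w))
    split = trans (replicate-+-++ (a + 9) a b w) (replicate-+-++ a 9 b (replicate a b ++ w))

offsetTwins-oddStairs : ∀ k c → OffsetTwins [] 16 (stairs 0 (suc k) (suc (2 * c)) [])
offsetTwins-oddStairs k c =
  subst (λ j → OffsetTwins [] 16 (stairs 0 (suc j) t [])) (sym k≡)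
    (byBlocks (k / 8) (k % 8) (m%n<n k 8))
  where
    t = suc (2 * c)
    k≡ : k ≡ k / 8 * 8 + k % 8
    k≡ = trans (m≡m%n+[m/n]*n k 8) (+-comm (k % 8) (k / 8 * 8))
    firstRun-length : ∀ K R c →
      4 + K * 8 + R + c + 9 + (4 + K * 8 + R + c) ≡ 2 * (suc K * 8 + R) + suc (2 * c)
    firstRun-length = solve-∀
    byBlocks : ∀ K R → R < 8 → OffsetTwins [] 16 (stairs 0 (suc (K * 8 + R)) t [])
    byBlocks zero R R<8 =
      offsetTwins-weaken (+-monoˡ-≤ 0 (≤-trans R<8 (m≤m+n 8 8)))
        (offsetTwins-halves 0 (suc R) t offsetTwins-[])
    byBlocks (suc K) R R<8 =
      offsetTwins-absorb (4 + K * 8 + R + c) _ true (firstRun-length K R c)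
        (subst (OffsetTwins _ _) (sym (stairs-+ 1 (suc K * 8) R t []))
          (offsetTwins-weaken (+-monoʳ-≤ 9 (+-monoˡ-≤ 0 (≤-pred R<8)))
            (offsetTwins-blocks K 1 (2 * R + t)
              (offsetTwins-halves (suc K * 8 + 1) R t offsetTwins-[]))))

odd-split : ∀ {m k} → Odd m → 2 * k < m → m ≡ 2 * k + suc (2 * (m / 2 ∸ k))
odd-split {m} {k} m-odd 2k<m = sym (begin
  2 * k + suc (2 * (h ∸ k)) ≡⟨ +-suc (2 * k) (2 * (h ∸ k)) ⟩
  suc (2 * k + 2 * (h ∸ k)) ≡⟨ cong suc (*-distribˡ-+ 2 k (h ∸ k)) ⟨
  suc (2 * (k + (h ∸ k)))   ≡⟨ cong (λ j → suc (2 * j)) (m+[n∸m]≡n k≤h) ⟩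
  suc (2 * h)               ≡⟨ m≡ ⟨
  m                         ∎)
  where
    open ≡-Reasoning
    h = m / 2
    m≡ : m ≡ suc (2 * h)
    m≡ = trans (m≡m%n+[m/n]*n m 2) (cong₂ _+_ m-odd (*-comm h 2))
    k≤h : k ≤ h
    k≤h = *-cancelˡ-≤ 2 (≤-pred (subst (2 * k <_) m≡ 2k<m))

proposition5p1 : (m r : ℕ) → Odd m → 1 ≤ m → 1 ≤ r → m ≥ 2 * r ∸ 1 →
    Σ ℕ (λ k → Twins (O m r) k × length (O m r) ∸ 23 ≤ 2 * k)
proposition5p1 m zero    _     _ () _
proposition5p1 m (suc k) m-odd _ _  m≥2k+1 =
  offsetTwins⇒twins (offsetTwins-weaken (m≤m+n 16 7)
    (subst (OffsetTwins [] 16) (sym O≡stairs) (offsetTwins-oddStairs k c)))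
  where
    c = m / 2 ∸ k
    2k<m : 2 * k < m
    2k<m = subst (_≤ m) (cong (_∸ 1) (*-suc 2 k)) m≥2k+1
    O≡stairs : O m (suc k) ≡ stairs 0 (suc k) (suc (2 * c)) []
    O≡stairs = trans (cong (λ l → runsFrom l 0 (suc k)) (odd-split {k = k} m-odd 2k<m))
                     (runsFrom-stairs 0 k (suc (2 * c)))
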